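{- Let $\varepsilon:L^{(2)}\to 2^N$ be a Fitch map. Then $\varepsilon$ is a type-C Fitch map if and only if its least-resolved tree $(T_\varepsilon,\lambda_\varepsilon)$ satisfies condition (C).
   Context: $L,N$ finite, $L^{(2)}=\{(x,y)\mid x,y\in L,\ x\ne y\}$. Trees are rooted phylogenetic (every inner vertex has $\ge2$ children) with leaf set $L$; $V^0(T)$ is the set of inner vertices, $\operatorname{child}(v)$ the children of $v$, $L(T(u))$ the leaves below $u$. $(T,\lambda)$ with $\lambda:E(T)\to 2^N$ explains $\varepsilon$ if for all $(x,y)\in L^{(2)}$, $k\in N$: $k\in\varepsilon(x,y)$ iff $k\in\lambda(e)$ for some edge $e$ on the path from $\operatorname{lca}_T(x,y)$ to $y$; $\varepsilon$ is a Fitch map if some such tree explains it. Condition (C) for $(T,\lambda)$: for every $v\in V^0(T)$ there is $u\in\operatorname{child}(v)$ with $\lambda(\{v,u\})=\emptyset$. $\varepsilon$ is a type-C Fitch map if it is explained by some $(T,\lambda)$ satisfying (C). The least-resolved tree $(T_\varepsilon,\lambda_\varepsilon)$ is the tree whose cluster set $\{L(T_\varepsilon(u))\}$ equals $\{U_{\neg m}[y]\mid y\in L,m\in N\}\cup\{L\}\cup\{\{x\}\mid x\in L\}$, where $U_{\neg m}[y]=\{x\in L\setminus\{y\}\mid m\notin\varepsilon(x,y)\}\cup\{y\}$, with $\lambda_\varepsilon(\{\operatorname{parent}(v),v\})=\{m\in N\mid\exists y\in L: L(T_\varepsilon(v))=U_{\neg m}[y]\}$. -}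

module Defs where

open import Data.Nat using (ℕ; _≤_)
open import Data.Fin using (Fin)
open import Data.Fin.Subset using (Subset; _∈_; _∉_)
open import Data.List using (List; []; _∷_; _++_; length; allFin)
open import Data.List.Membership.Propositional using () renaming (_∈_ to _∈ₗ_)
open import Data.List.Relation.Binary.Permutation.Propositional using (_↭_)
open import Data.Product using (Σ; ∃; ∃-syntax; _×_; _,_)
open import Data.Sum using (_⊎_)
open import Data.Unit using (⊤)
open import Relation.Nullary using (¬_)
open import Relation.Binary.PropositionalEquality using (_≡_; _≢_)
open import Function.Bundles using (_⇔_)

-- Leaves are Fin n (the set L), colours are Fin m (the set N).
-- A rooted tree whose edges carry labels in 2^N: each inner vertex stores
-- the list of its children, each paired with the label λ of the edge
-- from the vertex to that child.
data Tree (n m : ℕ) : Set where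
  leaf : Fin n → Tree n m
  node : List (Subset m × Tree n m) → Tree n m

module _ {n m : ℕ} where

  leaves : Tree n m → List (Fin n)
  leavesF : List (Subset m × Tree n m) → List (Fin n)
  leaves (leaf x) = x ∷ []
  leaves (node cs) = leavesF cs
  leavesF [] = []
  leavesF ((_ , c) ∷ cs) = leaves c ++ leavesF cs

  Cl : Tree n m → Fin n → Set
  Cl t x = x ∈ₗ leaves t

  Phylo : Tree n m → Set
  PhyloF : List (Subset m × Tree n m) → Set
  Phylo (leaf _) = ⊤
  Phylo (node cs) = (2 ≤ length cs) × PhyloF cs
  PhyloF [] = ⊤
  PhyloF ((_ , c) ∷ cs) = Phylo c × PhyloF cs

  IsTree : Tree n m → Set
  IsTree t = Phylo t × (leaves t ↭ allFin n)

  -- s is the subtree rooted at some vertex of t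
  data _≼_ (s : Tree n m) : Tree n m → Set where
    here  : s ≼ s
    below : ∀ {cs l c} → (l , c) ∈ₗ cs → s ≼ c → s ≼ node cs

  -- some edge on the path from the root of t to leaf y carries colour k
  data RootPath (k : Fin m) (y : Fin n) : Tree n m → Set where
    hereE  : ∀ {cs l c} → (l , c) ∈ₗ cs → Cl c y → k ∈ l → RootPath k y (node cs)
    thereE : ∀ {cs l c} → (l , c) ∈ₗ cs → Cl c y → RootPath k y c → RootPath k y (node cs)

  -- some edge on the path from lca_t(x,y) to y carries colour k
  data LcaPath (k : Fin m) (x y : Fin n) : Tree n m → Set where
    deeper : ∀ {cs l c} → (l , c) ∈ₗ cs → Cl c x → Cl c y →
             LcaPath k x y c → LcaPath k x y (node cs)
    atLca  : ∀ {cs l c} → (l , c) ∈ₗ cs → Cl c y → ¬ Cl c x → Cl (node cs) x →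
             (k ∈ l ⊎ RootPath k y c) → LcaPath k x y (node cs)

  -- (T, λ) explains ε  (ε is only consulted on L^(2), i.e. for x ≢ y)
  Explains : (Fin n → Fin n → Subset m) → Tree n m → Set
  Explains ε t = ∀ (x y : Fin n) → x ≢ y → ∀ (k : Fin m) → (k ∈ ε x y ⇔ LcaPath k x y t)

  Fitch : (Fin n → Fin n → Subset m) → Set
  Fitch ε = ∃[ t ] (IsTree t × Explains ε t)

  SatC : Tree n m → Set
  SatC t = ∀ cs → node cs ≼ t → ∃[ l ] ∃[ c ] ((l , c) ∈ₗ cs × (∀ (k : Fin m) → k ∉ l))

  TypeC : (Fin n → Fin n → Subset m) → Set
  TypeC ε = ∃[ t ] (IsTree t × SatC t × Explains ε t)

  U : (Fin n → Fin n → Subset m) → Fin m → Fin n → Fin n → Set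
  U ε k y x = (x ≢ y × k ∉ ε x y) ⊎ x ≡ y

  _≐_ : (Fin n → Set) → (Fin n → Set) → Set
  A ≐ B = ∀ x → (A x ⇔ B x)

  InClusterFamily : (Fin n → Fin n → Subset m) → (Fin n → Set) → Set
  InClusterFamily ε A =
    (∃[ y ] ∃[ k ] (A ≐ U ε k y)) ⊎ ((∀ x → A x) ⊎ (∃[ x ] (A ≐ (λ z → z ≡ x))))

  -- (t, λ) is the least-resolved tree (T_ε, λ_ε) of ε (unique up to isomorphism):
  -- its cluster set equals the family above, and each edge into a vertex v
  -- is labelled {k | ∃ y. L(T(v)) = U_{¬k}[y]}.
  LeastResolved : (Fin n → Fin n → Subset m) → Tree n m → Set
  LeastResolved ε t =
    (∀ s → s ≼ t → InClusterFamily ε (Cl s)) ×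
    (∀ (y : Fin n) (k : Fin m) → ∃[ s ] (s ≼ t × Cl s ≐ U ε k y)) ×
    (∃[ s ] (s ≼ t × Cl s ≐ (λ _ → ⊤))) ×
    (∀ (x : Fin n) → ∃[ s ] (s ≼ t × Cl s ≐ (λ z → z ≡ x))) ×
    (∀ cs l c → node cs ≼ t → (l , c) ∈ₗ cs →
       ∀ (k : Fin m) → (k ∈ l ⇔ (∃[ y ] (Cl c ≐ U ε k y))))

-- (⇐) The least-resolved tree explains ε, so when it satisfies (C) it witnesses
-- that ε is of type C.
-- (⇒) Let (T, λ) satisfy (C) and explain ε. Every set U_{¬k}[y] is a cluster of T
-- (L itself, or the leaves below the lowest k-labelled edge on the path from the root
-- to y), so every inner vertex v of T_ε has a counterpart w in T with the same leaves.
-- Following unlabelled edges down from w reaches a leaf y, lying in some child c of v.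
-- If the edge from v to c carried a colour k, then L(c) = U_{¬k}[z] for some z, and a
-- leaf x below v but not below c would get k ∈ ε(x, y); yet lca_T(x, y) lies below w,
-- and the path from w to y carries no colour.
module Submission where

open import Defs
open import Data.Nat using (ℕ; s≤s)
open import Data.Fin using (Fin) renaming (_≟_ to _≟ᶠ_)
open import Data.Fin.Subset using (Subset; _∈_; _∉_)
open import Data.Fin.Subset.Properties using () renaming (_∈?_ to _∈ˢ?_)
open import Data.List using (List; []; _∷_; _++_)
open import Data.List.Membership.Propositional using () renaming (_∈_ to _∈ₗ_)
open import Data.List.Membership.Propositional.Properties
  using (∈-++⁺ˡ; ∈-++⁺ʳ; ∈-++⁻; ∈-allFin)
import Data.List.Membership.DecPropositional as DecMembership
open import Data.List.Relation.Unary.Any using (here; there)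
open import Data.List.Relation.Unary.All as All using (All; []; _∷_)
import Data.List.Relation.Unary.All.Properties as All
open import Data.List.Relation.Unary.AllPairs using ([]; _∷_)
open import Data.List.Relation.Unary.Unique.Propositional using (Unique)
open import Data.List.Relation.Unary.Unique.Propositional.Properties using (allFin⁺)
open import Data.List.Relation.Binary.Permutation.Propositional using (↭-sym; ↭⇒↭ₛ)
open import Data.List.Relation.Binary.Permutation.Propositional.Properties using (∈-resp-↭)
open import Data.List.Relation.Binary.Permutation.Setoid.Properties using (Unique-resp-↭)
open import Data.Product using (∃-syntax; _×_; _,_)
open import Data.Sum using (_⊎_; inj₁; inj₂)
open import Data.Empty using (⊥-elim)
open import Relation.Nullary using (¬_; Dec; yes; no)
open import Relation.Binary.PropositionalEquality using (_≡_; _≢_; refl; sym; trans; subst; setoid)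
open import Function.Bundles using (_⇔_; mk⇔; Equivalence)
open import Function.Construct.Composition using (_⇔-∘_)
open import Function.Construct.Symmetry using (⇔-sym)

open Equivalence

module _ {n m : ℕ} where

  private
    variable
      k : Fin m
      x y z : Fin n
      l l′ : Subset m
      s t c c′ v w : Tree n m
      cs : List (Subset m × Tree n m)
      ε : Fin n → Fin n → Subset m

  -- `_≐_` leaves the number of colours undetermined, so it is fixed once here.
  _≐′_ : (Fin n → Set) → (Fin n → Set) → Set
  _≐′_ = _≐_ {m = m}

  Cl? : ∀ (t : Tree n m) x → Dec (Cl t x)
  Cl? t x = x ∈? leaves t
    where open DecMembership (_≟ᶠ_ {n})

  Edge : Tree n m → Subset m → Tree n m → Set
  Edge t l v = ∃[ cs ] (node cs ≼ t × (l , v) ∈ₗ cs)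

  Uncoloured : Subset m → Set
  Uncoloured l = ∀ (k : Fin m) → k ∉ l

  child-⊆ : (l , c) ∈ₗ cs → Cl c x → Cl (node cs) x
  child-⊆ (here refl) xc = ∈-++⁺ˡ xc
  child-⊆ {cs = (_ , c′) ∷ _} (there p) xc = ∈-++⁺ʳ (leaves c′) (child-⊆ p xc)

  ≼-⊆ : s ≼ t → Cl s x → Cl t x
  ≼-⊆ here xs = xs
  ≼-⊆ (below p h) xs = child-⊆ p (≼-⊆ h xs)

  ≼-trans : s ≼ t → t ≼ w → s ≼ w
  ≼-trans h here = h
  ≼-trans h (below p h′) = below p (≼-trans h h′)

  child-containing : Cl (node cs) x → ∃[ l ] ∃[ c ] ((l , c) ∈ₗ cs × Cl c x)
  child-containing {cs = (l , c) ∷ cs} xt with ∈-++⁻ (leaves c) xt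
  ... | inj₁ xc = l , c , here refl , xc
  ... | inj₂ xr with child-containing xr
  ...   | l′ , c′ , p , xc′ = l′ , c′ , there p , xc′

  ≼-root-or-edge : s ≼ t → s ≡ t ⊎ ∃[ l ] Edge t l s
  ≼-root-or-edge here = inj₁ refl
  ≼-root-or-edge (below {cs} {l} p h) with ≼-root-or-edge h
  ... | inj₁ refl = inj₂ (l , cs , here , p)
  ... | inj₂ (l′ , cs′ , h′ , q) = inj₂ (l′ , cs′ , ≼-trans h′ (below p here) , q)

  Unique-++⁻ˡ : ∀ (xs : List (Fin n)) {ys} → Unique (xs ++ ys) → Unique xs
  Unique-++⁻ˡ [] _ = []
  Unique-++⁻ˡ (_ ∷ xs) (x∉ ∷ u) = All.++⁻ˡ xs x∉ ∷ Unique-++⁻ˡ xs u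

  Unique-++⁻ʳ : ∀ (xs : List (Fin n)) {ys} → Unique (xs ++ ys) → Unique ys
  Unique-++⁻ʳ [] u = u
  Unique-++⁻ʳ (_ ∷ xs) (_ ∷ u) = Unique-++⁻ʳ xs u

  Unique-++-disjoint : ∀ (xs : List (Fin n)) {ys} → Unique (xs ++ ys) → x ∈ₗ xs → ¬ x ∈ₗ ys
  Unique-++-disjoint (_ ∷ xs) (x∉ ∷ _) (here refl) q = All.lookup x∉ (∈-++⁺ʳ xs q) refl
  Unique-++-disjoint (_ ∷ xs) (_ ∷ u) (there p) q = Unique-++-disjoint xs u p q

  child-Unique : Unique (leaves (node cs)) → (l , c) ∈ₗ cs → Unique (leaves c)
  child-Unique {cs = (_ , c) ∷ _} u (here refl) = Unique-++⁻ˡ (leaves c) u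
  child-Unique {cs = (_ , c) ∷ _} u (there p) = child-Unique (Unique-++⁻ʳ (leaves c) u) p

  ≼-Unique : Unique (leaves t) → s ≼ t → Unique (leaves s)
  ≼-Unique u here = u
  ≼-Unique u (below p h) = ≼-Unique (child-Unique u p) h

  child-unique : Unique (leaves (node cs)) → (l , c) ∈ₗ cs → (l′ , c′) ∈ₗ cs →
                 Cl c x → Cl c′ x → (l , c) ≡ (l′ , c′)
  child-unique u (here refl) (here refl) _ _ = refl
  child-unique {cs = (_ , c) ∷ _} u (here refl) (there q) xc xc′ =
    ⊥-elim (Unique-++-disjoint (leaves c) u xc (child-⊆ q xc′))
  child-unique {cs = (_ , c) ∷ _} u (there p) (here refl) xc xc′ =
    ⊥-elim (Unique-++-disjoint (leaves c) u xc′ (child-⊆ p xc))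
  child-unique {cs = (_ , c) ∷ _} u (there p) (there q) xc xc′ =
    child-unique (Unique-++⁻ʳ (leaves c) u) p q xc xc′

  Phylo-nonempty : ∀ (t : Tree n m) → Phylo t → ∃[ x ] Cl t x
  Phylo-nonempty (leaf x) _ = x , here refl
  Phylo-nonempty (node ((_ , c) ∷ _)) (_ , pc , _) with Phylo-nonempty c pc
  ... | x , xc = x , ∈-++⁺ˡ xc

  child-Phylo : PhyloF cs → (l , c) ∈ₗ cs → Phylo c
  child-Phylo (pc , _) (here refl) = pc
  child-Phylo (_ , pcs) (there p) = child-Phylo pcs p

  ≼-Phylo : Phylo t → s ≼ t → Phylo s
  ≼-Phylo pt here = pt
  ≼-Phylo (_ , pcs) (below p h) = ≼-Phylo (child-Phylo pcs p) h

  outside-child : Phylo (node cs) → Unique (leaves (node cs)) → (l , c) ∈ₗ cs →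
                  ∃[ x ] (Cl (node cs) x × ¬ Cl c x)
  outside-child {cs = cs@((_ , a) ∷ (_ , b) ∷ _)} (_ , _ , pb , _) u (here refl)
    with Phylo-nonempty b pb
  ... | x , xb = x , child-⊆ {cs = cs} (there (here refl)) xb ,
                 λ xa → Unique-++-disjoint (leaves a) u xa (∈-++⁺ˡ xb)
  outside-child {cs = (_ , a) ∷ _ ∷ _} (_ , pa , _) u (there p) with Phylo-nonempty a pa
  ... | x , xa = x , ∈-++⁺ˡ xa ,
                 λ xc → Unique-++-disjoint (leaves a) u xa (child-⊆ p xc)
  outside-child {cs = _ ∷ []} (s≤s () , _) _ (here refl)
  outside-child {cs = _ ∷ []} (s≤s () , _) _ (there ())

  inner-cluster-not-singleton : Phylo (node cs) → Unique (leaves (node cs)) →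
                                ¬ (Cl (node cs) ≐′ (_≡ z))
  inner-cluster-not-singleton {cs} pt u singleton with Phylo-nonempty (node cs) pt
  ... | y , yt with child-containing yt
  ... | _ , c , p , yc with outside-child pt u p
  ... | x , xt , ¬xc = ¬xc (subst (Cl c) (trans (to (singleton y) yt) (sym (to (singleton x) xt))) yc)

  IsTree-covers : IsTree t → ∀ x → Cl t x
  IsTree-covers (_ , perm) x = ∈-resp-↭ (↭-sym perm) (∈-allFin x)

  IsTree-Unique : IsTree t → Unique (leaves t)
  IsTree-Unique (_ , perm) = Unique-resp-↭ (setoid (Fin n)) (↭⇒↭ₛ (↭-sym perm)) (allFin⁺ n)

  LcaPath⇒RootPath : LcaPath k x y t → RootPath k y t
  LcaPath⇒RootPath (deeper p _ yc lp) = thereE p yc (LcaPath⇒RootPath lp)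
  LcaPath⇒RootPath (atLca p yc _ _ (inj₁ k∈l)) = hereE p yc k∈l
  LcaPath⇒RootPath (atLca p yc _ _ (inj₂ rp)) = thereE p yc rp

  RootPath-edge : RootPath k y t → ∃[ l ] ∃[ v ] (Edge t l v × k ∈ l × Cl v y)
  RootPath-edge (hereE {cs} {l} {c} p yc k∈l) = l , c , (cs , here , p) , k∈l , yc
  RootPath-edge (thereE p _ rp) with RootPath-edge rp
  ... | l , v , (cs , h , q) , k∈l , yv = l , v , (cs , ≼-trans h (below p here) , q) , k∈l , yv

  LcaPath-edge : LcaPath k x y t → ∃[ l ] ∃[ v ] (Edge t l v × k ∈ l × Cl v y × ¬ Cl v x)
  LcaPath-edge (deeper p _ _ lp) with LcaPath-edge lp
  ... | l , v , (cs , h , q) , k∈l , yv , ¬xv =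
    l , v , (cs , ≼-trans h (below p here) , q) , k∈l , yv , ¬xv
  LcaPath-edge (atLca {cs} {l} {c} p yc ¬xc _ (inj₁ k∈l)) = l , c , (cs , here , p) , k∈l , yc , ¬xc
  LcaPath-edge (atLca p _ ¬xc _ (inj₂ rp)) with RootPath-edge rp
  ... | l , v , (cs , h , q) , k∈l , yv =
    l , v , (cs , ≼-trans h (below p here) , q) , k∈l , yv , λ xv → ¬xc (≼-⊆ h (child-⊆ q xv))

  RootPath-from-edge : node cs ≼ t → (l , v) ∈ₗ cs → Cl v y → k ∈ l → RootPath k y t
  RootPath-from-edge here q yv k∈l = hereE q yv k∈l
  RootPath-from-edge (below p h) q yv k∈l =
    thereE p (≼-⊆ h (child-⊆ q yv)) (RootPath-from-edge h q yv k∈l)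

  LcaPath-from-edge : node cs ≼ t → (l , v) ∈ₗ cs → Cl v y → ¬ Cl v x → Cl t x →
                      k ∈ l → LcaPath k x y t
  LcaPath-from-edge here q yv ¬xv xt k∈l = atLca q yv ¬xv xt (inj₁ k∈l)
  LcaPath-from-edge {x = x} (below {c = c} p h) q yv ¬xv xt k∈l with Cl? c x
  ... | yes xc = deeper p xc (≼-⊆ h (child-⊆ q yv)) (LcaPath-from-edge h q yv ¬xv xc k∈l)
  ... | no ¬xc = atLca p (≼-⊆ h (child-⊆ q yv)) ¬xc xt (inj₂ (RootPath-from-edge h q yv k∈l))

  LcaPath-source : LcaPath k x y t → Cl t x
  LcaPath-source (deeper p xc _ _) = child-⊆ p xc
  LcaPath-source (atLca _ _ _ xt _) = xt

  -- The k-edge separating z from x also separates y from x, or else it would separate z from y.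
  LcaPath-redirect : LcaPath k x z t → ¬ LcaPath k y z t → Cl t y → LcaPath k x y t
  LcaPath-redirect {y = y} xz ¬yz yt with LcaPath-edge xz
  ... | l , v , (_ , h , q) , k∈l , zv , ¬xv with Cl? v y
  ...   | yes yv = LcaPath-from-edge h q yv ¬xv (LcaPath-source xz) k∈l
  ...   | no ¬yv = ⊥-elim (¬yz (LcaPath-from-edge h q zv ¬yv yt k∈l))

  ¬U⇒∈ε : ¬ U ε k z x → x ≢ z × k ∈ ε x z
  ¬U⇒∈ε {ε = ε} {k} {z} {x} ¬u with x ≟ᶠ z
  ... | yes x≡z = ⊥-elim (¬u (inj₂ x≡z))
  ... | no x≢z with k ∈ˢ? ε x z
  ...   | yes k∈ = x≢z , k∈
  ...   | no k∉ = ⊥-elim (¬u (inj₁ (x≢z , k∉)))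

  colour-separates : Fitch ε → x ≢ y → U ε k z y → ¬ U ε k z x → k ∈ ε x y
  colour-separates {ε = ε} _ _ yU ¬xU with ¬U⇒∈ε {ε = ε} ¬xU | yU
  ... | _ , k∈εxz | inj₂ refl = k∈εxz
  colour-separates {x = x} {y} {k} {z} (T , tree , explains) x≢y _ _
      | x≢z , k∈εxz | inj₁ (y≢z , k∉εyz) =
    from (explains x y x≢y k)
      (LcaPath-redirect (to (explains x z x≢z k) k∈εxz)
                        (λ yz → k∉εyz (from (explains y z y≢z k) yz))
                        (IsTree-covers tree y))

  LeastResolved⇒Explains : Fitch ε → IsTree t → LeastResolved ε t → Explains ε t
  LeastResolved⇒Explains {ε = ε} {t = t} fitch tree (_ , U-vertex , _ , _ , edge-label) x y x≢y k =
    mk⇔ coloured⇒path path⇒coloured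
    where
    coloured⇒path : k ∈ ε x y → LcaPath k x y t
    coloured⇒path k∈ with U-vertex y k
    ... | s , s≼t , s≐U = via (≼-root-or-edge s≼t)
      where
      x∉s : ¬ Cl s x
      x∉s xs with to (s≐U x) xs
      ... | inj₁ (_ , k∉) = k∉ k∈
      ... | inj₂ x≡y = x≢y x≡y
      via : s ≡ t ⊎ ∃[ l ] Edge t l s → LcaPath k x y t
      via (inj₁ refl) = ⊥-elim (x∉s (IsTree-covers tree x))
      via (inj₂ (l , cs , h , q)) =
        LcaPath-from-edge h q (from (s≐U y) (inj₂ refl)) x∉s (IsTree-covers tree x)
                          (from (edge-label cs l s h q k) (y , s≐U))
    path⇒coloured : LcaPath k x y t → k ∈ ε x y
    path⇒coloured lp with LcaPath-edge lp
    ... | l , v , (cs , h , q) , k∈l , yv , ¬xv with to (edge-label cs l v h q k) k∈l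
    ...   | _ , v≐U =
      colour-separates {ε = ε} fitch x≢y (to (v≐U y) yv) (λ xU → ¬xv (from (v≐U x) xU))

  -- Either no edge on the path from the root to y carries k, or s lies below the
  -- lowest such edge, so that x ∉ s exactly when the path from lca(x, y) to y carries k.
  LowestColour : Fin m → Fin n → Tree n m → Set
  LowestColour k y t =
    ¬ RootPath k y t ⊎
    (RootPath k y t ×
     ∃[ s ] (s ≼ t × Cl s y × (∀ x → Cl t x → (LcaPath k x y t ⇔ (¬ Cl s x)))))

  LcaPath-into-child : Unique (leaves (node cs)) → (l , c) ∈ₗ cs → Cl c y → Cl c x →
                       LcaPath k x y (node cs) → LcaPath k x y c
  LcaPath-into-child u p yc xc (deeper q _ yc′ lp) with child-unique u p q yc yc′
  ... | refl = lp
  LcaPath-into-child u p yc xc (atLca q yc′ ¬xc _ _) with child-unique u p q yc yc′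
  ... | refl = ⊥-elim (¬xc xc)

  RootPath-into-child : Unique (leaves (node cs)) → (l , c) ∈ₗ cs → Cl c y → ¬ k ∈ l →
                        RootPath k y (node cs) → RootPath k y c
  RootPath-into-child u p yc k∉l (hereE q yc′ k∈l) with child-unique u p q yc yc′
  ... | refl = ⊥-elim (k∉l k∈l)
  RootPath-into-child u p yc k∉l (thereE q yc′ rp) with child-unique u p q yc yc′
  ... | refl = rp

  LowestColour-node : Unique (leaves (node cs)) → (l , c) ∈ₗ cs → Cl c y →
                      LowestColour k y c → LowestColour k y (node cs)
  LowestColour-node {cs = cs} {c = c} {y = y} {k = k} u p yc (inj₂ (rp , s , s≼c , ys , cut)) =
    inj₂ (thereE p yc rp , s , below p s≼c , ys , cut′)
    where
    cut′ : ∀ x → Cl (node cs) x → (LcaPath k x y (node cs) ⇔ (¬ Cl s x))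
    cut′ x xt with Cl? c x
    ... | yes xc = mk⇔ (λ lp → to (cut x xc) (LcaPath-into-child u p yc xc lp))
                       (λ ¬xs → deeper p xc yc (from (cut x xc) ¬xs))
    ... | no ¬xc = mk⇔ (λ _ xs → ¬xc (≼-⊆ s≼c xs)) (λ _ → atLca p yc ¬xc xt (inj₂ rp))
  LowestColour-node {cs = cs} {l = l} {c = c} {y = y} {k = k} u p yc (inj₁ ¬rp) with k ∈ˢ? l
  ... | no k∉l = inj₁ (λ rp → ¬rp (RootPath-into-child u p yc k∉l rp))
  ... | yes k∈l = inj₂ (hereE p yc k∈l , c , below p here , yc , cut′)
    where
    cut′ : ∀ x → Cl (node cs) x → (LcaPath k x y (node cs) ⇔ (¬ Cl c x))
    cut′ x xt with Cl? c x
    ... | yes xc = mk⇔ (λ lp → ⊥-elim (¬rp (LcaPath⇒RootPath (LcaPath-into-child u p yc xc lp))))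
                       (λ ¬xc → ⊥-elim (¬xc xc))
    ... | no ¬xc = mk⇔ (λ _ → ¬xc) (λ _ → atLca p yc ¬xc xt (inj₁ k∈l))

  lowestColour : ∀ (t : Tree n m) → Unique (leaves t) → Cl t y → LowestColour k y t
  lowestColours : ∀ (cs : List (Subset m × Tree n m)) →
                  All (λ (_ , c) → Unique (leaves c) → Cl c y → LowestColour k y c) cs
  lowestColour (leaf _) _ _ = inj₁ λ ()
  lowestColour (node cs) u yt with child-containing yt
  ... | _ , _ , p , yc =
    LowestColour-node u p yc (All.lookup (lowestColours cs) p (child-Unique u p) yc)
  lowestColours [] = []
  lowestColours ((_ , c) ∷ cs) = lowestColour c ∷ lowestColours cs

  U-cluster : Explains ε t → IsTree t → ∀ (k : Fin m) (y : Fin n) →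
              ∃[ s ] (s ≼ t × Cl s ≐′ U ε k y)
  U-cluster {ε = ε} {t = t} explains tree k y
    with lowestColour {k = k} t (IsTree-Unique tree) (IsTree-covers tree y)
  ... | inj₁ ¬rp = t , here , λ x → mk⇔ (λ _ → all-in-U x) (λ _ → IsTree-covers tree x)
    where
    all-in-U : ∀ x → U ε k y x
    all-in-U x with x ≟ᶠ y
    ... | yes x≡y = inj₂ x≡y
    ... | no x≢y = inj₁ (x≢y , λ k∈ → ¬rp (LcaPath⇒RootPath (to (explains x y x≢y k) k∈)))
  ... | inj₂ (_ , s , s≼t , ys , cut) = s , s≼t , λ x → mk⇔ (in-s⇒U x) (U⇒in-s x)
    where
    in-s⇒U : ∀ x → Cl s x → U ε k y x
    in-s⇒U x xs with x ≟ᶠ y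
    ... | yes x≡y = inj₂ x≡y
    ... | no x≢y =
      inj₁ (x≢y , λ k∈ → to (cut x (IsTree-covers tree x)) (to (explains x y x≢y k) k∈) xs)
    U⇒in-s : ∀ x → U ε k y x → Cl s x
    U⇒in-s x (inj₂ refl) = ys
    U⇒in-s x (inj₁ (x≢y , k∉)) with Cl? s x
    ... | yes xs = xs
    ... | no ¬xs = ⊥-elim (k∉ (from (explains x y x≢y k) (from (cut x (IsTree-covers tree x)) ¬xs)))

  inner-cluster-transfer : Explains ε t → IsTree t → IsTree s → LeastResolved ε s →
                           node cs ≼ s →
                           ∃[ w ] (w ≼ t × Cl w ≐′ Cl (node cs))
  inner-cluster-transfer explains tree _ (in-family , _) h with in-family _ h
  ... | inj₁ (y , k , v≐U) with U-cluster explains tree k y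
  ...   | w , w≼t , w≐U = w , w≼t , λ x → ⇔-sym (v≐U x) ⇔-∘ w≐U x
  inner-cluster-transfer {t = t} _ tree _ _ _ | inj₂ (inj₁ everything) =
    t , here , λ x → mk⇔ (λ _ → everything x) (λ _ → IsTree-covers tree x)
  inner-cluster-transfer _ _ tree′@(phylo′ , _) _ h | inj₂ (inj₂ (_ , singleton)) =
    ⊥-elim (inner-cluster-not-singleton (≼-Phylo phylo′ h) (≼-Unique (IsTree-Unique tree′) h)
                                        singleton)

  data EmptyPath (y : Fin n) : Tree n m → Set where
    stop : EmptyPath y (leaf y)
    step : (l , c) ∈ₗ cs → Uncoloured l → EmptyPath y c → EmptyPath y (node cs)

  EmptyPath-target : EmptyPath y t → Cl t y
  EmptyPath-target stop = here refl
  EmptyPath-target (step p _ ep) = child-⊆ p (EmptyPath-target ep)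

  SatC⇒EmptyPath : ∀ (t : Tree n m) → SatC t → ∃[ y ] EmptyPath y t
  SatC⇒EmptyPaths : ∀ (cs : List (Subset m × Tree n m)) →
                    All (λ (_ , c) → SatC c → ∃[ y ] EmptyPath y c) cs
  SatC⇒EmptyPath (leaf y) _ = y , stop
  SatC⇒EmptyPath (node cs) satC with satC cs here
  ... | _ , _ , p , uncoloured
    with All.lookup (SatC⇒EmptyPaths cs) p (λ cs′ h → satC cs′ (below p h))
  ...   | y , ep = y , step p uncoloured ep
  SatC⇒EmptyPaths [] = []
  SatC⇒EmptyPaths ((_ , c) ∷ cs) = SatC⇒EmptyPath c ∷ SatC⇒EmptyPaths cs

  EmptyPath-edge : Unique (leaves t) → EmptyPath y t → Edge t l v → Cl v y → Uncoloured l
  EmptyPath-edge u (step p uncoloured ep) (_ , here , q) yv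
    with child-unique u p q (EmptyPath-target ep) yv
  ... | refl = uncoloured
  EmptyPath-edge u (step p _ ep) (cs , below q h , r) yv
    with child-unique u p q (EmptyPath-target ep) (≼-⊆ h (child-⊆ r yv))
  ... | refl = EmptyPath-edge (child-Unique u p) ep (cs , h , r) yv

  EmptyPath-¬LcaPath : Unique (leaves t) → w ≼ t → EmptyPath y w → Cl w x → ¬ LcaPath k x y t
  EmptyPath-¬LcaPath u here ep _ lp with LcaPath-edge lp
  ... | _ , _ , e , k∈l , yv , _ = EmptyPath-edge u ep e yv _ k∈l
  EmptyPath-¬LcaPath u (below p h) ep xw (deeper q _ yc lp)
    with child-unique u p q (≼-⊆ h (EmptyPath-target ep)) yc
  ... | refl = EmptyPath-¬LcaPath (child-Unique u p) h ep xw lp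
  EmptyPath-¬LcaPath u (below p h) ep xw (atLca q yc ¬xc _ _)
    with child-unique u p q (≼-⊆ h (EmptyPath-target ep)) yc
  ... | refl = ¬xc (≼-⊆ h xw)

  TypeC⇒LeastResolved-SatC : TypeC ε → IsTree t → LeastResolved ε t → SatC t
  TypeC⇒LeastResolved-SatC {ε = ε} (T , tree , satC , explains)
                           tree′@(phylo′ , _) lr@(_ , _ , _ , _ , edge-label) cs h
    with inner-cluster-transfer explains tree tree′ lr h
  ... | w , w≼T , w≐v with SatC⇒EmptyPath w (λ cs′ h′ → satC cs′ (≼-trans h′ w≼T))
  ... | y , ep with child-containing (to (w≐v y) (EmptyPath-target ep))
  ... | l , c , p , yc = l , c , p , uncoloured
    where
    uncoloured : Uncoloured l
    uncoloured k k∈l with to (edge-label cs l c h p k) k∈l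
    ... | z , c≐U with outside-child (≼-Phylo phylo′ h) (≼-Unique (IsTree-Unique tree′) h) p
    ... | x , xv , ¬xc =
      EmptyPath-¬LcaPath (IsTree-Unique tree) w≼T ep (from (w≐v x) xv)
        (to (explains x y x≢y k)
            (colour-separates {ε = ε} (T , tree , explains) x≢y
                              (to (c≐U y) yc) (λ xU → ¬xc (from (c≐U x) xU))))
      where
      x≢y : x ≢ y
      x≢y refl = ¬xc yc

corollary3 : ∀ {n m : ℕ} (ε : Fin n → Fin n → Subset m) → Fitch ε →
               (t : Tree n m) → IsTree t → LeastResolved ε t →
               (TypeC ε ⇔ SatC t)
corollary3 ε fitch t tree lr =
  mk⇔ (λ typeC → TypeC⇒LeastResolved-SatC typeC tree lr)
      (λ satC → t , tree , satC , LeastResolved⇒Explains fitch tree lr)
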